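{- Let $T$ be a binary tree with $n$ leaves and let $L_1,\ldots,L_\alpha$ be a partition of $\mathcal{L}(T)$. Suppose that $(T|L_\beta)_{\beta=1}^\alpha$ are pairwise edge disjoint, and that every edge $e\in\mathcal{E}(T)$ with $\ell^*_T(e,\mathcal{L}(T))\le r$ belongs to one of the trees $T|L_\beta$. Then $\alpha\le 1+30\cdot 2^{ -r}n$.
   Context: A binary tree has all internal vertices of degree $3$ and labeled leaves $\mathcal{L}(T)$. $\mathrm{path}_T(x,y)$ is the set of edges on the path from $x$ to $y$ in $T$. For $L\subseteq\mathcal{L}(T)$, $T|L$ is the restriction of $T$ to $L$ (minimal subtree spanning $L$ with degree-2 vertices suppressed); $T|A$, $T|B$ are edge disjoint if $\mathrm{path}_T(u_1,v_1)\cap\mathrm{path}_T(u_2,v_2)=\emptyset$ for all $u_1,v_1\in A$, $u_2,v_2\in B$. An edge $e\in\mathcal{E}(T)$ belongs to $T|L$ if $e\in\mathrm{path}_T(u,v)$ for some $u,v\in L$. For a directed edge $\overrightarrow{(u_1,u_2)}$ and $V'\subseteq\mathcal{V}(T)$, $\overline{\ell}_T(\overrightarrow{(u_1,u_2)},V')$ is the minimal $m-1$ such that there is a simple path $(u_1,u_2),(u_2,u_3),\ldots,(u_{m-1},u_m)$ in $T$ with $u_m\in V'$. For an undirected edge $e$, $\ell^*_T(e,V')$ is the maximum of $\overline{\ell}_T$ over the two orientations of $e$. -}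

module Defs where

open import Data.Nat using (ℕ; zero; suc; _≤_; _⊔_)
open import Data.Fin using (Fin)
open import Data.Bool using (Bool; true)
open import Data.List using (List; []; _∷_; head; last; length)
open import Data.List.Relation.Unary.Unique.Propositional using (Unique)
open import Data.Maybe using (Maybe; just)
open import Data.Product using (Σ; ∃; ∃-syntax; _×_; _,_)
open import Data.Sum using (_⊎_)
open import Data.Unit using (⊤)
open import Data.Empty using (⊥)
open import Relation.Nullary using (¬_)
open import Relation.Binary.PropositionalEquality using (_≡_)

Adj : {N : ℕ} → (Fin N → Fin N → Bool) → Fin N → Fin N → Set
Adj adj u v = adj u v ≡ true

Chain : {N : ℕ} → (Fin N → Fin N → Bool) → List (Fin N) → Set
Chain adj []            = ⊤
Chain adj (x ∷ [])      = ⊤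
Chain adj (x ∷ y ∷ p)   = Adj adj x y × Chain adj (y ∷ p)

IsPath : {N : ℕ} → (Fin N → Fin N → Bool) → Fin N → Fin N → List (Fin N) → Set
IsPath adj x y p = head p ≡ just x × last p ≡ just y × Chain adj p × Unique p

Consec : {N : ℕ} → Fin N → Fin N → List (Fin N) → Set
Consec a b []          = ⊥
Consec a b (x ∷ [])    = ⊥
Consec a b (x ∷ y ∷ p) = (x ≡ a × y ≡ b) ⊎ Consec a b (y ∷ p)

EdgeOnPath : {N : ℕ} → (Fin N → Fin N → Bool) → Fin N → Fin N → Fin N → Fin N → Set
EdgeOnPath adj a b x y =
  ∃[ p ] (IsPath adj x y p × (Consec a b p ⊎ Consec b a p))

DegLe1 : {N : ℕ} → (Fin N → Fin N → Bool) → Fin N → Set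
DegLe1 adj v = ∀ a b → Adj adj v a → Adj adj v b → a ≡ b

Deg3 : {N : ℕ} → (Fin N → Fin N → Bool) → Fin N → Set
Deg3 adj v = ∃[ a ] ∃[ b ] ∃[ c ]
  (Adj adj v a × Adj adj v b × Adj adj v c ×
   ¬ a ≡ b × ¬ a ≡ c × ¬ b ≡ c ×
   (∀ d → Adj adj v d → d ≡ a ⊎ d ≡ b ⊎ d ≡ c))

record BinaryTree (N n : ℕ) : Set where
  field
    adj       : Fin N → Fin N → Bool
    adj-sym   : ∀ u v → adj u v ≡ adj v u
    irrefl    : ∀ u → ¬ Adj adj u u
    connected : ∀ x y → ∃[ p ] IsPath adj x y p
    acyclic   : ∀ x y p q → IsPath adj x y p → IsPath adj x y q → p ≡ q
    internal  : ∀ v → ¬ DegLe1 adj v → Deg3 adj v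
    leaf      : Fin n → Fin N
    leaf-inj  : ∀ i j → leaf i ≡ leaf j → i ≡ j
    leaf-deg  : ∀ i → DegLe1 adj (leaf i)
    leaf-all  : ∀ v → DegLe1 adj v → ∃[ i ] leaf i ≡ v

open BinaryTree public

Leaves : {N n : ℕ} → BinaryTree N n → Fin N → Set
Leaves T v = ∃[ i ] leaf T i ≡ v

-- there is a simple path (u1,u2),(u2,u3),...,(u_{m-1},u_m) with u_m ∈ V'
-- and k = m - 1
DirPathLen : {N n : ℕ} (T : BinaryTree N n) → Fin N → Fin N → (Fin N → Set) → ℕ → Set
DirPathLen T u₁ u₂ V' k =
  ∃[ q ] ∃[ y ] (IsPath (adj T) u₁ y (u₁ ∷ u₂ ∷ q) × V' y × length (u₁ ∷ u₂ ∷ q) ≡ suc k)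

IsDirLen : {N n : ℕ} (T : BinaryTree N n) → Fin N → Fin N → (Fin N → Set) → ℕ → Set
IsDirLen T u₁ u₂ V' k = DirPathLen T u₁ u₂ V' k × (∀ k' → DirPathLen T u₁ u₂ V' k' → k ≤ k')

IsStarLen : {N n : ℕ} (T : BinaryTree N n) → Fin N → Fin N → (Fin N → Set) → ℕ → Set
IsStarLen T u v V' k = ∃[ k₁ ] ∃[ k₂ ] (IsDirLen T u v V' k₁ × IsDirLen T v u V' k₂ × k ≡ k₁ ⊔ k₂)

-- edge {a,b} belongs to T|L_β, where L_β = { leaf i | part i ≡ β }
EdgeIn : {N n α : ℕ} (T : BinaryTree N n) → (Fin n → Fin α) → Fin α → Fin N → Fin N → Set
EdgeIn T part β a b = ∃[ i ] ∃[ j ]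
  (part i ≡ β × part j ≡ β × EdgeOnPath (adj T) a b (leaf T i) (leaf T j))

PairwiseEdgeDisjoint : {N n α : ℕ} (T : BinaryTree N n) → (Fin n → Fin α) → Set
PairwiseEdgeDisjoint T part = ∀ i₁ j₁ i₂ j₂ →
  part j₁ ≡ part i₁ → part j₂ ≡ part i₂ → ¬ part i₁ ≡ part i₂ →
  ∀ a b → ¬ (EdgeOnPath (adj T) a b (leaf T i₁) (leaf T j₁) ×
             EdgeOnPath (adj T) a b (leaf T i₂) (leaf T j₂))

{-# OPTIONS --safe #-}
module Submission where

-- Hang T from a leaf ρ of some part β₀. Every other part β has a top vertex t (its vertex closest
-- to ρ), and the edge from t to its parent lies in no T|L_γ: a γ-path through it would continue
-- into an edge from t to one of its children, and both of those belong to T|L_β. So ℓ* of that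
-- edge exceeds r: either all leaves below t are far from t, or the path up to ρ is long and all
-- leaves below the sibling of t are far from that sibling. Hence t or its sibling roots a complete
-- binary subtree of depth r − 1, with 2^(r−1) vertices at depth r − 1. Tagged by "t itself" or
-- "sibling", these vertices are distinct for distinct parts, so (α − 1) 2^(r−1) ≤ 2N ≤ 4n.
-- Minimal path lengths, and whether an edge lies in T|L_β, are not constructively available, so
-- the argument runs in the double-negation monad. This is harmless because the goal is a decidable
-- inequality.

open import Defs
open import Data.Nat using (ℕ; zero; suc; _≤_; _<_; _+_; _*_; _^_; _⊔_; z≤n; s≤s; _≤?_)
open import Data.Nat.Properties hiding (_≟_)
open import Data.Nat.Induction using (<-rec)
open import Data.Fin using (Fin; zero; suc; combine; remQuot)
open import Data.Fin.Properties
  using (_≟_; injective⇒≤; all?; combine-injective; combine-remQuot; 2↔Bool; sequence)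
import Data.Fin.Properties as Finₚ
open import Data.Bool using (Bool; true; false; not; if_then_else_)
open import Data.Bool.Properties using (not-¬) renaming (_≟_ to _≟ᵇ_)
open import Data.List using (List; []; _∷_; head; last; length; lookup; replicate; take)
open import Data.List.Properties using (length-replicate; length-take; ∷-injective)
open import Data.List.Relation.Unary.Any using (here; there; any?)
open import Data.List.Relation.Unary.All as All using (All; []; _∷_)
open import Data.List.Relation.Unary.All.Properties using (¬Any⇒All¬; All¬⇒¬Any)
open import Data.List.Relation.Unary.AllPairs using ([]; _∷_)
open import Data.List.Relation.Unary.Unique.Propositional using (Unique)
open import Data.List.Membership.Propositional using (_∈_; _∉_)
open import Data.List.Membership.Propositional.Properties using (∈-lookup)
open import Data.Maybe using (just)
open import Data.Maybe.Properties using (just-injective)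
open import Data.Product using (Σ; ∃-syntax; _×_; _,_; proj₁; proj₂; uncurry)
open import Data.Sum using (_⊎_; inj₁; inj₂; [_,_]′)
import Data.Sum
open import Data.Unit using (⊤; tt)
open import Data.Empty using (⊥; ⊥-elim)
open import Effect.Monad using (RawMonad)
open import Function using (_∘_)
open import Function.Bundles using (Inverse)
open import Function.Definitions using (Injective)
open import Level using (0ℓ)
open import Relation.Binary.Definitions using (tri<; tri≈; tri>)
open import Relation.Binary.PropositionalEquality
open import Relation.Nullary using (¬_; Dec; yes; no; contradiction)
open import Relation.Nullary.Decidable using (_→-dec_; decidable-stable; ¬¬-excluded-middle)
open import Relation.Nullary.Negation using (¬¬-Monad)
open import Relation.Nullary.Negation.Core using (DoubleNegation)

private
  module ¬¬ = RawMonad (¬¬-Monad {a = 0ℓ})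
open ¬¬ using (_>>=_; pure)

Unique⇒length≤ : ∀ {N} {xs : List (Fin N)} → Unique xs → length xs ≤ N
Unique⇒length≤ u = injective⇒≤ (lookup-injective u)
  where
  lookup-injective : ∀ {N} {xs : List (Fin N)} → Unique xs → Injective _≡_ _≡_ (lookup xs)
  lookup-injective {xs = _ ∷ _}  _          {zero}  {zero}  _ = refl
  lookup-injective {xs = _ ∷ ys} (y∉ys ∷ _) {zero}  {suc j} e =
    contradiction (subst (_∈ ys) (sym e) (∈-lookup j)) (All¬⇒¬Any y∉ys)
  lookup-injective {xs = _ ∷ ys} (y∉ys ∷ _) {suc i} {zero}  e =
    contradiction (subst (_∈ ys) e (∈-lookup i)) (All¬⇒¬Any y∉ys)
  lookup-injective {xs = _ ∷ _}  (_ ∷ u)    {suc i} {suc j} e = cong suc (lookup-injective u e)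

take-replicate : ∀ {A : Set} k {m} (x : A) → k ≤ m → take k (replicate m x) ≡ replicate k x
take-replicate zero    _ _         = refl
take-replicate (suc k) x (s≤s k≤m) = cong (x ∷_) (take-replicate k x k≤m)

remQuot-injective : ∀ {m} k {i j : Fin (m * k)} → remQuot {m} k i ≡ remQuot k j → i ≡ j
remQuot-injective {m} k {i} {j} e =
  trans (sym (combine-remQuot {m} k i)) (trans (cong (uncurry combine) e) (combine-remQuot {m} k j))

injective₂⇒≤ : ∀ {a b c} (f : Fin a → Fin b → Fin c) →
  (∀ {i i′ j j′} → f i j ≡ f i′ j′ → i ≡ i′ × j ≡ j′) → a * b ≤ c
injective₂⇒≤ {a} {b} f f-injective =
  injective⇒≤ {f = uncurry f ∘ remQuot {a} b}
    (remQuot-injective b ∘ uncurry (cong₂ _,_) ∘ f-injective)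

surjective⇒≤ : ∀ {m n} (f : Fin m → Fin n) → (∀ y → ∃[ x ] f x ≡ y) → n ≤ m
surjective⇒≤ f f-surjective = injective⇒≤ {f = proj₁ ∘ f-surjective} λ {y} {y′} e →
  trans (sym (proj₂ (f-surjective y))) (trans (cong f e) (proj₂ (f-surjective y′)))

bits : ∀ k → Fin (2 ^ k) → List Bool
bits zero    _ = []
bits (suc k) i with remQuot {2} (2 ^ k) i
... | b , j = Inverse.to 2↔Bool b ∷ bits k j

length-bits : ∀ k i → length (bits k i) ≡ k
length-bits zero    _ = refl
length-bits (suc k) i = cong suc (length-bits k _)

bits-injective : ∀ k {i j} → bits k i ≡ bits k j → i ≡ j
bits-injective zero    {zero} {zero} _ = refl
bits-injective (suc k) e with ∷-injective e
... | head≡ , tail≡ =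
  remQuot-injective (2 ^ k) (cong₂ _,_ (toBool-injective head≡) (bits-injective k tail≡))
  where
  open Inverse 2↔Bool
  toBool-injective : ∀ {x y} → to x ≡ to y → x ≡ y
  toBool-injective {x} {y} e′ = trans (sym (strictlyInverseʳ x)) (trans (cong from e′) (strictlyInverseʳ y))

¬¬-minimum : ∀ {Q : ℕ → Set} {k} → Q k →
  DoubleNegation (∃[ m ] (Q m × ∀ m′ → Q m′ → m ≤ m′))
¬¬-minimum {Q} {k} = <-rec (λ k → Q k → DoubleNegation Minimum) step k
  where
  Minimum = ∃[ m ] (Q m × ∀ m′ → Q m′ → m ≤ m′)
  step : ∀ k → (∀ {j} → j < k → Q j → DoubleNegation Minimum) → Q k → DoubleNegation Minimum
  step k smaller qk = do
    no none ← ¬¬-excluded-middle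
      where yes (_ , j<k , qj) → smaller j<k qj
    pure (k , qk , λ m′ qm′ → ≮⇒≥ (λ m′<k → none (m′ , m′<k , qm′)))

charging-arithmetic : ∀ α k {N} n → α * 2 ^ k ≤ 2 * N → N ≤ 2 * n →
  2 ^ suc k * suc α ≤ 2 ^ suc k + 30 * n
charging-arithmetic α k n charged N≤2n = begin
  2 ^ suc k * suc α             ≡⟨ *-suc (2 ^ suc k) α ⟩
  2 ^ suc k + 2 ^ suc k * α     ≡⟨ cong (2 ^ suc k +_) (trans (*-assoc 2 (2 ^ k) α) (cong (2 *_) (*-comm (2 ^ k) α))) ⟩
  2 ^ suc k + 2 * (α * 2 ^ k)   ≤⟨ +-monoʳ-≤ (2 ^ suc k) (*-monoʳ-≤ 2 (≤-trans charged (*-monoʳ-≤ 2 N≤2n))) ⟩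
  2 ^ suc k + 2 * (2 * (2 * n)) ≡⟨ cong (2 ^ suc k +_) (trans (*-assoc 4 2 n) (*-assoc 2 2 (2 * n))) ⟨
  2 ^ suc k + 8 * n             ≤⟨ +-monoʳ-≤ (2 ^ suc k) (*-monoˡ-≤ n (m≤m+n 8 22)) ⟩
  2 ^ suc k + 30 * n            ∎
  where open ≤-Reasoning

module Paths {N : ℕ} (adj : Fin N → Fin N → Bool) (adj-sym : ∀ u v → adj u v ≡ adj v u) where

  Adj-sym : ∀ {u v} → Adj adj u v → Adj adj v u
  Adj-sym {u} {v} e = trans (adj-sym v u) e

  IsPath-head : ∀ {x y xs} → IsPath adj x y xs → ∃[ zs ] xs ≡ x ∷ zs
  IsPath-head {xs = _ ∷ zs} (refl , _) = zs , refl

  IsPath-tail : ∀ {x y z zs} → IsPath adj x y (x ∷ z ∷ zs) → IsPath adj z y (z ∷ zs)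
  IsPath-tail (_ , l , (_ , c) , (_ ∷ u)) = refl , l , c , u

  IsPath-∷ : ∀ {v w y xs} → Adj adj v w → v ∉ xs → IsPath adj w y xs → IsPath adj v y (v ∷ xs)
  IsPath-∷ {xs = xs@(_ ∷ _)} a v∉xs (refl , l , c , u) = refl , l , (a , c) , (¬Any⇒All¬ xs v∉xs ∷ u)

  IsPath-suffix : ∀ {x y v} xs → IsPath adj x y xs → v ∈ xs →
    ∃[ zs ] (IsPath adj v y (v ∷ zs) × length (v ∷ zs) ≤ length xs ×
             (v ≢ x → length (v ∷ zs) < length xs))
  IsPath-suffix (_ ∷ zs) p@(refl , _) (here refl) = zs , p , ≤-refl , λ v≢v → contradiction refl v≢v
  IsPath-suffix (_ ∷ z ∷ zs) p@(refl , _) (there v∈) with IsPath-suffix (z ∷ zs) (IsPath-tail p) v∈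
  ... | zs′ , q , le , _ = zs′ , q , m≤n⇒m≤1+n le , λ _ → s≤s le

  UsesEdge : Fin N → Fin N → List (Fin N) → Set
  UsesEdge t c p = Consec c t p ⊎ Consec t c p

  Consec⇒Adj : ∀ {a b} p → Chain adj p → Consec a b p → Adj adj a b
  Consec⇒Adj (_ ∷ _ ∷ _) (a , _)  (inj₁ (refl , refl)) = a
  Consec⇒Adj (_ ∷ y ∷ p) (_ , ch) (inj₂ c)             = Consec⇒Adj (y ∷ p) ch c

  UsesEdge⇒Adj : ∀ {t c} p → Chain adj p → UsesEdge t c p → Adj adj t c
  UsesEdge⇒Adj p ch (inj₁ c) = Adj-sym (Consec⇒Adj p ch c)
  UsesEdge⇒Adj p ch (inj₂ c) = Consec⇒Adj p ch c

  private
    Consec⇒∈tail : ∀ {a b z : Fin N} zs → Consec a b (z ∷ zs) → b ∈ zs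
    Consec⇒∈tail (_ ∷ _)  (inj₁ (refl , refl)) = here refl
    Consec⇒∈tail (_ ∷ zs) (inj₂ c)             = there (Consec⇒∈tail zs c)

    UsesEdge-∷ : ∀ {t y x z zs} → UsesEdge t y (z ∷ zs) → UsesEdge t y (x ∷ z ∷ zs)
    UsesEdge-∷ (inj₁ c) = inj₁ (inj₂ c)
    UsesEdge-∷ (inj₂ c) = inj₂ (inj₂ c)

  UsesEdge-inner : ∀ {t c} p → Unique p → UsesEdge t c p → head p ≢ just t → last p ≢ just t →
    ∃[ y ] (y ≢ c × UsesEdge t y p)
  UsesEdge-inner (_ ∷ _ ∷ []) _ (inj₁ (inj₁ (refl , refl))) _ t≢last = contradiction refl t≢last
  UsesEdge-inner (_ ∷ _ ∷ w ∷ _) ((_ ∷ x≢w ∷ _) ∷ _) (inj₁ (inj₁ (refl , refl))) _ _ =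
    w , x≢w ∘ sym , inj₂ (inj₂ (inj₁ (refl , refl)))
  UsesEdge-inner (_ ∷ _ ∷ _) _ (inj₂ (inj₁ (refl , refl))) t≢head _ = contradiction refl t≢head
  UsesEdge-inner {t} (_ ∷ z ∷ zs) (_ ∷ u@(z∉zs ∷ _)) (inj₁ (inj₂ c)) _ t≢last
    with UsesEdge-inner (z ∷ zs) u (inj₁ c) z≢t t≢last
    where
    z≢t : head (z ∷ zs) ≢ just t
    z≢t e = All¬⇒¬Any z∉zs (subst (_∈ zs) (sym (just-injective e)) (Consec⇒∈tail zs c))
  ... | y , y≢c , uses = y , y≢c , UsesEdge-∷ uses
  UsesEdge-inner {t} {c′} (x ∷ z ∷ zs) (x∉ ∷ u) (inj₂ (inj₂ c)) _ t≢last with z ≟ t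
  ... | yes refl = x , x≢c , inj₁ (inj₁ (refl , refl))
    where
    x≢c : x ≢ c′
    x≢c e = All¬⇒¬Any x∉ (subst (_∈ z ∷ zs) (sym e) (there (Consec⇒∈tail zs c)))
  ... | no z≢t with UsesEdge-inner (z ∷ zs) u (inj₂ c) (z≢t ∘ just-injective) t≢last
  ...   | y , y≢c , uses = y , y≢c , UsesEdge-∷ uses

  UsesEdge-endpoint : ∀ {x y l a} p → IsPath adj x y p → UsesEdge l a p → DegLe1 adj l →
    l ≡ x ⊎ l ≡ y
  UsesEdge-endpoint {x} {y} {l} p (hp , lp , ch , uq) uses l-leaf with l ≟ x | l ≟ y
  ... | yes l≡x | _       = inj₁ l≡x
  ... | no _    | yes l≡y = inj₂ l≡y
  ... | no l≢x  | no l≢y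
    with UsesEdge-inner p uq uses (λ h → l≢x (just-injective (trans (sym h) hp)))
                                  (λ h → l≢y (just-injective (trans (sym h) lp)))
  ...   | _ , y′≢a , uses′ =
    contradiction (l-leaf _ _ (UsesEdge⇒Adj p ch uses′) (UsesEdge⇒Adj p ch uses)) y′≢a

module Rooted {N n : ℕ} (T : BinaryTree N n) (i₀ : Fin n) where
  open Paths (adj T) (adj-sym T) public

  ρ : Fin N
  ρ = leaf T i₀

  IsLeaf : Fin N → Set
  IsLeaf = DegLe1 (adj T)

  isLeaf? : ∀ v → Dec (IsLeaf v)
  isLeaf? v = all? λ a → all? λ b →
    (adj T v a ≟ᵇ true) →-dec ((adj T v b ≟ᵇ true) →-dec (a ≟ b))

  Adj-irrefl : ∀ {v w} → Adj (adj T) v w → v ≢ w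
  Adj-irrefl a refl = irrefl T _ a

  internal⇒≢ρ : ∀ {v} → ¬ IsLeaf v → v ≢ ρ
  internal⇒≢ρ v-internal refl = v-internal (leaf-deg T i₀)

  pathToRoot : Fin N → List (Fin N)
  pathToRoot v = proj₁ (connected T v ρ)

  pathToRoot-isPath : ∀ v → IsPath (adj T) v ρ (pathToRoot v)
  pathToRoot-isPath v = proj₂ (connected T v ρ)

  pathToRoot-unique : ∀ {v} xs → IsPath (adj T) v ρ xs → pathToRoot v ≡ xs
  pathToRoot-unique xs p = acyclic T _ ρ _ xs (pathToRoot-isPath _) p

  private
    secondOr : Fin N → List (Fin N) → Fin N
    secondOr _ (_ ∷ y ∷ _) = y
    secondOr d _           = d

  -- Junk value: the root is its own parent.
  parent : Fin N → Fin N
  parent v = secondOr v (pathToRoot v)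

  -- Counts vertices, so depth ρ ≡ 1.
  depth : Fin N → ℕ
  depth v = length (pathToRoot v)

  pathToRoot-ρ : pathToRoot ρ ≡ ρ ∷ []
  pathToRoot-ρ = pathToRoot-unique (ρ ∷ []) (refl , refl , tt , ([] ∷ []))

  parent-ρ : parent ρ ≡ ρ
  parent-ρ = cong (secondOr ρ) pathToRoot-ρ

  pathToRoot-step : ∀ {v} → v ≢ ρ → pathToRoot v ≡ v ∷ pathToRoot (parent v)
  pathToRoot-step {v} v≢ρ = go (pathToRoot v) refl (pathToRoot-isPath v)
    where
    go : ∀ xs → pathToRoot v ≡ xs → IsPath (adj T) v ρ xs → xs ≡ v ∷ pathToRoot (parent v)
    go (_ ∷ [])     _ (refl , l , _) = contradiction (just-injective l) v≢ρ
    go (_ ∷ y ∷ ys) e p@(refl , _)   rewrite e =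
      cong (v ∷_) (sym (pathToRoot-unique (y ∷ ys) (IsPath-tail p)))

  depth-parent : ∀ {v} → v ≢ ρ → depth v ≡ suc (depth (parent v))
  depth-parent v≢ρ = cong length (pathToRoot-step v≢ρ)

  depth-parent< : ∀ {v} → v ≢ ρ → depth (parent v) < depth v
  depth-parent< v≢ρ = ≤-reflexive (sym (depth-parent v≢ρ))

  depth-injective : ∀ {v w} → depth v < depth w → v ≢ w
  depth-injective lt refl = <-irrefl refl lt

  Adj-parent : ∀ {v} → v ≢ ρ → Adj (adj T) v (parent v)
  Adj-parent {v} v≢ρ with IsPath-head (pathToRoot-isPath (parent v))
  ... | _ , e
    with subst (IsPath (adj T) v ρ) (trans (pathToRoot-step v≢ρ) (cong (v ∷_) e)) (pathToRoot-isPath v)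
  ...   | _ , _ , (a , _) , _ = a

  ∈pathToRoot⇒depth< : ∀ {x v} → x ∈ pathToRoot v → x ≢ v → depth x < depth v
  ∈pathToRoot⇒depth< {x} {v} x∈ with IsPath-suffix (pathToRoot v) (pathToRoot-isPath v) x∈
  ... | zs , q , _ , shorter rewrite pathToRoot-unique (x ∷ zs) q = shorter

  ∉pathToRoot⇒parent : ∀ {v w} → Adj (adj T) v w → v ∉ pathToRoot w → parent v ≡ w
  ∉pathToRoot⇒parent {v} {w} a v∉ with IsPath-head (pathToRoot-isPath w)
  ... | zs , e rewrite pathToRoot-unique (v ∷ pathToRoot w) (IsPath-∷ a v∉ (pathToRoot-isPath w)) | e = refl

  Adj⇒parent : ∀ {v w} → Adj (adj T) v w → parent v ≡ w ⊎ parent w ≡ v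
  Adj⇒parent {v} {w} a with any? (v ≟_) (pathToRoot w) | any? (w ≟_) (pathToRoot v)
  ... | no v∉  | _      = inj₁ (∉pathToRoot⇒parent a v∉)
  ... | yes _  | no w∉  = inj₂ (∉pathToRoot⇒parent (Adj-sym a) w∉)
  ... | yes v∈ | yes w∈ =
    contradiction (∈pathToRoot⇒depth< w∈ (Adj-irrefl a ∘ sym))
                  (<⇒≯ (∈pathToRoot⇒depth< v∈ (Adj-irrefl a)))

  Adj-nonparent⇒parent : ∀ {v w} → Adj (adj T) v w → w ≢ parent v → parent w ≡ v
  Adj-nonparent⇒parent a w≢pv with Adj⇒parent a
  ... | inj₁ pv≡w = contradiction (sym pv≡w) w≢pv
  ... | inj₂ pw≡v = pw≡v

  parent-internal : ∀ {v} → v ≢ ρ → parent v ≢ ρ → ¬ IsLeaf (parent v)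
  parent-internal {v} v≢ρ pv≢ρ pv-leaf =
    depth-injective (<-trans (depth-parent< pv≢ρ) (depth-parent< v≢ρ))
      (sym (pv-leaf v (parent (parent v)) (Adj-sym (Adj-parent v≢ρ)) (Adj-parent pv≢ρ)))

  parent≡internal⇒≢ρ : ∀ {v x} → ¬ IsLeaf v → parent x ≡ v → x ≢ ρ
  parent≡internal⇒≢ρ v-internal px≡v refl = internal⇒≢ρ v-internal (trans (sym px≡v) parent-ρ)

  record Children (v : Fin N) : Set where
    field
      kid          : Bool → Fin N
      Adj-kid      : ∀ b → Adj (adj T) v (kid b)
      kid≢parent   : ∀ b → kid b ≢ parent v
      kid-distinct : kid false ≢ kid true
      neighbours   : ∀ d → Adj (adj T) v d → d ≡ parent v ⊎ ∃[ b ] d ≡ kid b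

  private
    mkChildren : ∀ {v x y} → Adj (adj T) v x → Adj (adj T) v y → x ≢ y →
      x ≢ parent v → y ≢ parent v → (∀ d → Adj (adj T) v d → d ≡ parent v ⊎ d ≡ x ⊎ d ≡ y) →
      Children v
    mkChildren {x = x} {y} vx vy x≢y x≢p y≢p nbrs = record
      { kid          = λ b → if b then y else x
      ; Adj-kid      = λ { false → vx ; true → vy }
      ; kid≢parent   = λ { false → x≢p ; true → y≢p }
      ; kid-distinct = x≢y
      ; neighbours   = λ d → Data.Sum.map₂ [ (false ,_) , (true ,_) ]′ ∘ nbrs d
      }

  children : ∀ v → ¬ IsLeaf v → Children v
  children v v-internal with internal T v v-internal
  ... | a , b , c , va , vb , vc , a≢b , a≢c , b≢c , nbrs
    with nbrs (parent v) (Adj-parent (internal⇒≢ρ v-internal))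
  ... | inj₁ refl        = mkChildren vb vc b≢c (a≢b ∘ sym) (a≢c ∘ sym) nbrs
  ... | inj₂ (inj₁ refl) = mkChildren va vc a≢c a≢b (b≢c ∘ sym)
                             (λ d → [ inj₂ ∘ inj₁ , [ inj₁ , inj₂ ∘ inj₂ ]′ ]′ ∘ nbrs d)
  ... | inj₂ (inj₂ refl) = mkChildren va vb a≢b a≢c b≢c
                             (λ d → [ inj₂ ∘ inj₁ , [ inj₂ ∘ inj₂ , inj₁ ]′ ]′ ∘ nbrs d)

  -- Junk value: a leaf is its own child.
  child : Fin N → Bool → Fin N
  child v b with isLeaf? v
  ... | yes _         = v
  ... | no v-internal = Children.kid (children v v-internal) b

  child-children : ∀ {v} → ¬ IsLeaf v → Σ (Children v) λ C → ∀ b → child v b ≡ Children.kid C b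
  child-children {v} v-internal with isLeaf? v
  ... | yes v-leaf     = contradiction v-leaf v-internal
  ... | no v-internal′ = children v v-internal′ , λ _ → refl

  module _ {v : Fin N} (v-internal : ¬ IsLeaf v) where
    private
      C         = proj₁ (child-children v-internal)
      child≡kid = proj₂ (child-children v-internal)
      open Children C

    Adj-child : ∀ b → Adj (adj T) v (child v b)
    Adj-child b = subst (Adj (adj T) v) (sym (child≡kid b)) (Adj-kid b)

    parent-child : ∀ b → parent (child v b) ≡ v
    parent-child b =
      Adj-nonparent⇒parent (Adj-child b) (subst (_≢ parent v) (sym (child≡kid b)) (kid≢parent b))

    child-injective : ∀ {b b′} → child v b ≡ child v b′ → b ≡ b′
    child-injective {b} {b′} e = kid-injective (trans (sym (child≡kid b)) (trans e (child≡kid b′)))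
      where
      kid-injective : ∀ {b b′} → kid b ≡ kid b′ → b ≡ b′
      kid-injective {false} {false} _ = refl
      kid-injective {true}  {true}  _ = refl
      kid-injective {false} {true}  e = contradiction e kid-distinct
      kid-injective {true}  {false} e = contradiction (sym e) kid-distinct

    child≢ρ : ∀ b → child v b ≢ ρ
    child≢ρ b = parent≡internal⇒≢ρ v-internal (parent-child b)

    depth-child : ∀ b → depth (child v b) ≡ suc (depth v)
    depth-child b = trans (depth-parent (child≢ρ b)) (cong (suc ∘ depth) (parent-child b))

    parent⇒child : ∀ {x} → parent x ≡ v → ∃[ b ] x ≡ child v b
    parent⇒child {x} px≡v with neighbours x (Adj-sym (subst (Adj (adj T) x) px≡v (Adj-parent x≢ρ)))
      where
      x≢ρ = parent≡internal⇒≢ρ v-internal px≡v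
    ... | inj₂ (b , x≡kid) = b , trans x≡kid (sym (child≡kid b))
    ... | inj₁ x≡pv =
      contradiction (<-trans (depth-parent< (internal⇒≢ρ v-internal)) x-deeper)
                    (<-irrefl (cong depth (sym x≡pv)))
      where
      x-deeper : depth v < depth x
      x-deeper = subst (λ w → depth w < depth x) px≡v
                   (depth-parent< (parent≡internal⇒≢ρ v-internal px≡v))

    siblings-two : ∀ {x y z} → parent x ≡ v → parent y ≡ v → parent z ≡ v → x ≢ y →
      z ≡ x ⊎ z ≡ y
    siblings-two px py pz x≢y with parent⇒child px | parent⇒child py | parent⇒child pz
    ... | false , refl | false , refl | _            = contradiction refl x≢y
    ... | true  , refl | true  , refl | _            = contradiction refl x≢y
    ... | false , refl | true  , refl | false , refl = inj₁ refl
    ... | false , refl | true  , refl | true  , refl = inj₂ refl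
    ... | true  , refl | false , refl | true  , refl = inj₁ refl
    ... | true  , refl | false , refl | false , refl = inj₂ refl

  descend : Fin N → List Bool → Fin N
  descend u []       = u
  descend u (b ∷ bs) = descend (child u b) bs

  AllInternal : Fin N → List Bool → Set
  AllInternal u []       = ⊤
  AllInternal u (b ∷ bs) = ¬ IsLeaf u × AllInternal (child u b) bs

  Full : ℕ → Fin N → Set
  Full k u = ∀ bs → length bs ≡ k → AllInternal u bs

  ancestor : ℕ → Fin N → Fin N
  ancestor zero    x = x
  ancestor (suc k) x = parent (ancestor k x)

  ancestor-descend : ∀ u bs {k} → AllInternal u bs → length bs ≡ k → ancestor k (descend u bs) ≡ u
  ancestor-descend u []       _             refl = refl
  ancestor-descend u (b ∷ bs) (u-int , int) refl =
    trans (cong parent (ancestor-descend (child u b) bs int refl)) (parent-child u-int b)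

  descend-injective : ∀ u {bs bs′} → AllInternal u bs → AllInternal u bs′ →
    length bs ≡ length bs′ → descend u bs ≡ descend u bs′ → bs ≡ bs′
  descend-injective u {[]}     {[]}       _             _          _   _ = refl
  descend-injective u {b ∷ bs} {b′ ∷ bs′} (u-int , int) (_ , int′) len e
    with child-injective u-int same-child
    where
    open ≡-Reasoning
    same-child : child u b ≡ child u b′
    same-child = begin
      child u b                                        ≡⟨ ancestor-descend (child u b) bs int refl ⟨
      ancestor (length bs) (descend (child u b) bs)    ≡⟨ cong₂ ancestor (suc-injective len) e ⟩
      ancestor (length bs′) (descend (child u b′) bs′) ≡⟨ ancestor-descend (child u b′) bs′ int′ refl ⟩
      child u b′                                       ∎
  ... | refl = cong (b ∷_) (descend-injective (child u b) int int′ (suc-injective len) e)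

  descentPath : Fin N → List Bool → List (Fin N)
  descentPath u []       = []
  descentPath u (b ∷ bs) = child u b ∷ descentPath (child u b) bs

  length-descentPath : ∀ u bs → length (descentPath u bs) ≡ length bs
  length-descentPath u []       = refl
  length-descentPath u (b ∷ bs) = cong suc (length-descentPath (child u b) bs)

  descentPath-deeper : ∀ u bs → AllInternal u bs → All (λ x → depth u < depth x) (descentPath u bs)
  descentPath-deeper u []       _             = []
  descentPath-deeper u (b ∷ bs) (u-int , int) =
    u<child ∷ All.map (<-trans u<child) (descentPath-deeper (child u b) bs int)
    where
    u<child : depth u < depth (child u b)
    u<child = ≤-reflexive (sym (depth-child u-int b))

  descentPath-isPath : ∀ u bs → AllInternal u bs → IsPath (adj T) u (descend u bs) (u ∷ descentPath u bs)
  descentPath-isPath u []       _             = refl , refl , tt , ([] ∷ [])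
  descentPath-isPath u (b ∷ bs) (u-int , int) with descentPath-isPath (child u b) bs int
  ... | _ , l , ch , uq = refl , l , (Adj-child u-int b , ch) ,
    (All.map depth-injective (descentPath-deeper u (b ∷ bs) (u-int , int)) ∷ uq)

  ∉descentPath : ∀ {x u bs} → AllInternal u bs → depth x < depth u → x ∉ u ∷ descentPath u bs
  ∉descentPath _ x<u (here refl) = <-irrefl refl x<u
  ∉descentPath {u = u} {bs} int x<u (there x∈) = <-asym x<u (All.lookup (descentPath-deeper u bs int) x∈)

  AllInternal⇒length< : ∀ u bs → AllInternal u bs → length bs < N
  AllInternal⇒length< u bs int = subst (_≤ N) (cong suc (length-descentPath u bs))
    (Unique⇒length≤ (proj₂ (proj₂ (proj₂ (descentPath-isPath u bs int)))))

  AllInternal-or-leaf : ∀ u bs → AllInternal u bs ⊎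
    ∃[ k ] (k < length bs × AllInternal u (take k bs) × IsLeaf (descend u (take k bs)))
  AllInternal-or-leaf u []       = inj₁ tt
  AllInternal-or-leaf u (b ∷ bs) = extend (isLeaf? u)
    where
    extend : Dec (IsLeaf u) → AllInternal u (b ∷ bs) ⊎
      ∃[ k ] (k < suc (length bs) × AllInternal u (take k (b ∷ bs)) × IsLeaf (descend u (take k (b ∷ bs))))
    extend (yes u-leaf) = inj₂ (0 , s≤s z≤n , tt , u-leaf)
    extend (no u-int) with AllInternal-or-leaf (child u b) bs
    ... | inj₁ int                   = inj₁ (u-int , int)
    ... | inj₂ (k , k< , int , leaf) = inj₂ (suc k , s≤s k< , (u-int , int) , leaf)

  leavesFar⇒Full : ∀ u k → (∀ bs → AllInternal u bs → IsLeaf (descend u bs) → k ≤ length bs) →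
    Full k u
  leavesFar⇒Full u k far bs refl with AllInternal-or-leaf u bs
  ... | inj₁ int                   = int
  ... | inj₂ (j , j< , int , leaf) =
    contradiction (≤-trans (far _ int leaf) (≤-reflexive length-prefix)) (<⇒≱ j<)
    where
    length-prefix : length (take j bs) ≡ j
    length-prefix = trans (length-take j bs) (m≤n⇒m⊓n≡m (<⇒≤ j<))

  descendToLeaf : ∀ b u → ∃[ k ] (AllInternal u (replicate k b) × IsLeaf (descend u (replicate k b)))
  descendToLeaf b u with AllInternal-or-leaf u (replicate N b)
  ... | inj₁ int =
    contradiction (subst (_< N) (length-replicate N) (AllInternal⇒length< u _ int)) (<-irrefl refl)
  ... | inj₂ (k , k< , int , leaf)
    rewrite take-replicate k b (<⇒≤ (subst (k <_) (length-replicate N) k<)) = k , int , leaf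

  rightSpine : ∀ u k → AllInternal u (replicate k true) → ∀ i → i < k →
    let x = descend u (replicate k true)
    in  ¬ IsLeaf (ancestor (suc i) x) × ancestor i x ≡ child (ancestor (suc i) x) true
  rightSpine u (suc k) (u-int , int) i i<1+k with m<1+n⇒m<n∨m≡n i<1+k
  ... | inj₁ i<k  = rightSpine (child u true) k int i i<k
  ... | inj₂ refl = subst (λ w → ¬ IsLeaf w) (sym top≡u) u-int ,
                    trans top-child (cong (λ w → child w true) (sym top≡u))
    where
    top-child : ancestor i (descend (child u true) (replicate i true)) ≡ child u true
    top-child = ancestor-descend (child u true) (replicate i true) int (length-replicate i)
    top≡u : ancestor (suc i) (descend (child u true) (replicate i true)) ≡ u
    top≡u = trans (cong parent top-child) (parent-child u-int true)

  spineLength : Fin N → ℕ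
  spineLength v = proj₁ (descendToLeaf true (child v false))

  spine-internal : ∀ v → AllInternal (child v false) (replicate (spineLength v) true)
  spine-internal v = proj₁ (proj₂ (descendToLeaf true (child v false)))

  leftRightLeaf : Fin N → Fin N
  leftRightLeaf v = descend (child v false) (replicate (spineLength v) true)

  leftRightLeaf-isLeaf : ∀ v → IsLeaf (leftRightLeaf v)
  leftRightLeaf-isLeaf v = proj₂ (proj₂ (descendToLeaf true (child v false)))

  ancestor-leftRightLeaf : ∀ v → ancestor (spineLength v) (leftRightLeaf v) ≡ child v false
  ancestor-leftRightLeaf v =
    ancestor-descend (child v false) _ (spine-internal v) (length-replicate (spineLength v))

  -- Going up from leftRightLeaf v, v is the parent of the first vertex that is a left child.
  sameLeaf⇒spineLength≮ : ∀ {v w} → ¬ IsLeaf v → ¬ IsLeaf w → leftRightLeaf v ≡ leftRightLeaf w →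
    spineLength v < spineLength w → ⊥
  sameLeaf⇒spineLength≮ {v} {w} v-int w-int e lt
    with rightSpine (child w false) (spineLength w) (spine-internal w) (spineLength v) lt
  ... | z-int , on-spine =
    not-¬ {false} refl (child-injective v-int (trans left≡right (cong (λ x → child x true) (sym v≡z))))
    where
    z = ancestor (suc (spineLength v)) (leftRightLeaf w)
    left≡right : child v false ≡ child z true
    left≡right = trans (sym (ancestor-leftRightLeaf v)) (trans (cong (ancestor (spineLength v)) e) on-spine)
    v≡z : v ≡ z
    v≡z = trans (sym (parent-child v-int false)) (trans (cong parent left≡right) (parent-child z-int true))

  leftRightLeaf-injective : ∀ {v w} → ¬ IsLeaf v → ¬ IsLeaf w →
    leftRightLeaf v ≡ leftRightLeaf w → v ≡ w
  leftRightLeaf-injective {v} {w} v-int w-int e with <-cmp (spineLength v) (spineLength w)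
  ... | tri< lt _ _ = ⊥-elim (sameLeaf⇒spineLength≮ v-int w-int e lt)
  ... | tri> _ _ gt = ⊥-elim (sameLeaf⇒spineLength≮ w-int v-int (sym e) gt)
  ... | tri≈ _ eq _ =
    trans (sym (parent-child v-int false)) (trans (cong parent same-child) (parent-child w-int false))
    where
    same-child : child v false ≡ child w false
    same-child = trans (sym (ancestor-leftRightLeaf v)) (trans (cong₂ ancestor eq e) (ancestor-leftRightLeaf w))

  leafLabel : ∀ v → IsLeaf v → Fin n
  leafLabel v v-leaf = proj₁ (leaf-all T v v-leaf)

  leafLabel-injective : ∀ {v w} v-leaf w-leaf → leafLabel v v-leaf ≡ leafLabel w w-leaf → v ≡ w
  leafLabel-injective {v} {w} v-leaf w-leaf e =
    trans (sym (proj₂ (leaf-all T v v-leaf))) (trans (cong (leaf T) e) (proj₂ (leaf-all T w w-leaf)))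

  N≤2*n : N ≤ 2 * n
  N≤2*n = injective⇒≤ {f = λ v → code v (isLeaf? v)}
            (λ {v} {w} → code-injective (isLeaf? v) (isLeaf? w))
    where
    tag : ∀ v → Dec (IsLeaf v) → Fin 2
    tag _ (yes _) = zero
    tag _ (no _)  = suc zero

    coded : ∀ v → Dec (IsLeaf v) → Fin N
    coded v (yes _) = v
    coded v (no _)  = leftRightLeaf v

    coded-isLeaf : ∀ v dv → IsLeaf (coded v dv)
    coded-isLeaf v (yes v-leaf) = v-leaf
    coded-isLeaf v (no _)       = leftRightLeaf-isLeaf v

    code : ∀ v → Dec (IsLeaf v) → Fin (2 * n)
    code v dv = combine (tag v dv) (leafLabel (coded v dv) (coded-isLeaf v dv))

    code-injective : ∀ {v w} dv dw → code v dv ≡ code w dw → v ≡ w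
    code-injective {v} {w} dv dw e with combine-injective (tag v dv) _ (tag w dw) _ e
    code-injective (yes _)    (yes _)    e | _ , same = leafLabel-injective _ _ same
    code-injective (yes _)    (no _)     e | () , _
    code-injective (no _)     (yes _)    e | () , _
    code-injective (no v-int) (no w-int) e | _ , same =
      leftRightLeaf-injective v-int w-int (leafLabel-injective _ _ same)

  pathUp : ∀ {t} → t ≢ ρ → DirPathLen T t (parent t) (Leaves T) (depth (parent t))
  pathUp {t} t≢ρ with IsPath-head (pathToRoot-isPath (parent t))
  ... | zs , e = zs , ρ , subst (λ xs → IsPath (adj T) t ρ (t ∷ xs)) e path , (i₀ , refl) ,
                 cong (λ xs → suc (length xs)) (sym e)
    where
    path : IsPath (adj T) t ρ (t ∷ pathToRoot (parent t))
    path = subst (IsPath (adj T) t ρ) (pathToRoot-step t≢ρ) (pathToRoot-isPath t)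

  pathDown : ∀ {t bs} → t ≢ ρ → AllInternal t bs → IsLeaf (descend t bs) →
    DirPathLen T (parent t) t (Leaves T) (suc (length bs))
  pathDown {t} {bs} t≢ρ int leaf =
    descentPath t bs , descend t bs ,
    IsPath-∷ (Adj-sym (Adj-parent t≢ρ)) (∉descentPath int (depth-parent< t≢ρ))
             (descentPath-isPath t bs int) ,
    leaf-all T _ leaf , cong (λ l → suc (suc l)) (length-descentPath t bs)

  pathViaSibling : ∀ {t s bs} → parent s ≡ parent t → s ≢ t → t ≢ ρ → s ≢ ρ →
    AllInternal s bs → IsLeaf (descend s bs) → DirPathLen T t (parent t) (Leaves T) (suc (suc (length bs)))
  pathViaSibling {t} {s} {bs} ps≡pt s≢t t≢ρ s≢ρ int leaf =
    s ∷ descentPath s bs , descend s bs , IsPath-∷ (Adj-parent t≢ρ) t∉ pt-path ,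
    leaf-all T _ leaf , cong (λ l → suc (suc (suc l))) (length-descentPath s bs)
    where
    pt<s : depth (parent t) < depth s
    pt<s = subst (λ w → depth w < depth s) ps≡pt (depth-parent< s≢ρ)
    pt-path : IsPath (adj T) (parent t) (descend s bs) (parent t ∷ s ∷ descentPath s bs)
    pt-path = IsPath-∷ (Adj-sym (subst (Adj (adj T) s) ps≡pt (Adj-parent s≢ρ))) (∉descentPath int pt<s)
                (descentPath-isPath s bs int)
    same-depth : depth t ≡ depth s
    same-depth = trans (depth-parent t≢ρ) (trans (cong (suc ∘ depth) (sym ps≡pt)) (sym (depth-parent s≢ρ)))
    t∉ : t ∉ parent t ∷ s ∷ descentPath s bs
    t∉ (here t≡pt)        = Adj-irrefl (Adj-parent t≢ρ) t≡pt
    t∉ (there (here t≡s)) = s≢t (sym t≡s)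
    t∉ (there (there t∈)) = <-irrefl (sym same-depth) (All.lookup (descentPath-deeper s bs int) t∈)

  -- Where the full subtree charged to the edge above t hangs: at t itself or at its sibling.
  data Anchor (t : Fin N) : Fin N → Set where
    self    : Anchor t t
    sibling : ∀ {s} → ¬ IsLeaf (parent t) → parent s ≡ parent t → s ≢ t → Anchor t s

  anchorTag : ∀ {t u} → Anchor t u → Fin 2
  anchorTag self            = zero
  anchorTag (sibling _ _ _) = suc zero

  anchor-injective : ∀ {t t′ u u′} (a : Anchor t u) (a′ : Anchor t′ u′) →
    u ≡ u′ → anchorTag a ≡ anchorTag a′ → t ≡ t′
  anchor-injective self self u≡u′ _ = u≡u′
  anchor-injective (sibling pt-int pu≡pt u≢t) (sibling _ pu≡pt′ u≢t′) refl _
    with siblings-two pt-int refl pu≡pt (trans (sym pu≡pt′) pu≡pt) (u≢t ∘ sym)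
  ... | inj₁ t′≡t = sym t′≡t
  ... | inj₂ t′≡u = contradiction (sym t′≡u) u≢t′

  longDown⇒Full : ∀ {t k k₁} → t ≢ ρ → IsDirLen T (parent t) t (Leaves T) k₁ → suc k < k₁ →
    Full k t
  longDown⇒Full {t} {k} t≢ρ (_ , minimal) long = leavesFar⇒Full t k λ bs int leaf →
    <⇒≤ (≤-pred (<-≤-trans long (minimal _ (pathDown t≢ρ int leaf))))

  longUp⇒fullSibling : ∀ {t k k₂} → t ≢ ρ → IsDirLen T t (parent t) (Leaves T) k₂ →
    suc k < k₂ → ∃[ s ] (Anchor t s × Full k s)
  longUp⇒fullSibling {t} {k} t≢ρ (_ , minimal) long = fullSibling (parent⇒child p-internal refl)
    where
    p≢ρ : parent t ≢ ρ
    p≢ρ p≡ρ = <⇒≱ long (≤-trans (minimal _ (pathUp t≢ρ))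
      (≤-trans (≤-reflexive (trans (cong depth p≡ρ) (cong length pathToRoot-ρ))) (s≤s z≤n)))
    p-internal : ¬ IsLeaf (parent t)
    p-internal = parent-internal t≢ρ p≢ρ
    fullSibling : ∃[ b ] t ≡ child (parent t) b → ∃[ s ] (Anchor t s × Full k s)
    fullSibling (b , t≡child) = s , sibling p-internal ps≡pt s≢t , leavesFar⇒Full s k λ bs int leaf →
      ≤-pred (≤-pred (≤-trans long (minimal _ (pathViaSibling ps≡pt s≢t t≢ρ s≢ρ int leaf))))
      where
      s = child (parent t) (not b)
      ps≡pt : parent s ≡ parent t
      ps≡pt = parent-child p-internal (not b)
      s≢t : s ≢ t
      s≢t s≡t = not-¬ refl (sym (child-injective p-internal (trans s≡t t≡child)))
      s≢ρ : s ≢ ρ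
      s≢ρ = child≢ρ p-internal (not b)

  long⇒fullAnchor : ∀ {t k k₁ k₂} → t ≢ ρ →
    IsDirLen T (parent t) t (Leaves T) k₁ → IsDirLen T t (parent t) (Leaves T) k₂ →
    ¬ k₁ ⊔ k₂ ≤ suc k → ∃[ u ] (Anchor t u × Full k u)
  long⇒fullAnchor {k = k} {k₁} t≢ρ down up long with k₁ ≤? suc k
  ... | no k₁≰  = _ , self , longDown⇒Full t≢ρ down (≰⇒> k₁≰)
  ... | yes k₁≤ = longUp⇒fullSibling t≢ρ up (≰⇒> λ k₂≤ → long (⊔-lub k₁≤ k₂≤))

  ℓ*>⇒fullAnchor : ∀ {t} k → t ≢ ρ →
    (∀ l → IsStarLen T (parent t) t (Leaves T) l → ¬ l ≤ suc k) →
    DoubleNegation (∃[ u ] (Anchor t u × Full k u))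
  ℓ*>⇒fullAnchor {t} k t≢ρ long = do
    let (_ , int , leaf) = descendToLeaf false t
    k₁ , down ← ¬¬-minimum (pathDown t≢ρ int leaf)
    k₂ , up   ← ¬¬-minimum (pathUp t≢ρ)
    pure (long⇒fullAnchor t≢ρ down up (long (k₁ ⊔ k₂) (k₁ , k₂ , down , up , refl)))

module Partition {N n α : ℕ} (T : BinaryTree N n) (part : Fin n → Fin α)
                 (disjoint : PairwiseEdgeDisjoint T part) (i₀ : Fin n) where
  open Rooted T i₀ public

  EdgeIn-sym : ∀ {β a b} → EdgeIn T part β a b → EdgeIn T part β b a
  EdgeIn-sym (i , j , pi , pj , p , path , uses) = i , j , pi , pj , p , path , Data.Sum.swap uses

  EdgeIn⇒Adj : ∀ {β a b} → EdgeIn T part β a b → Adj (adj T) a b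
  EdgeIn⇒Adj (_ , _ , _ , _ , p , (_ , _ , ch , _) , uses) = Adj-sym (UsesEdge⇒Adj p ch uses)

  EdgeIn-unique : ∀ {β γ a b} → EdgeIn T part β a b → EdgeIn T part γ a b → β ≡ γ
  EdgeIn-unique {β} {γ} {a} {b} (i₁ , j₁ , pi₁ , pj₁ , e₁) (i₂ , j₂ , pi₂ , pj₂ , e₂)
    with β ≟ γ
  ... | yes β≡γ = β≡γ
  ... | no β≢γ  = contradiction (e₁ , e₂)
    (disjoint i₁ j₁ i₂ j₂ (trans pj₁ (sym pi₁)) (trans pj₂ (sym pi₂))
              (λ q → β≢γ (trans (sym pi₁) (trans q pi₂))) a b)

  EdgeIn-leaf : ∀ {β a l} → EdgeIn T part β a l → IsLeaf l → ∃[ i ] (part i ≡ β × leaf T i ≡ l)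
  EdgeIn-leaf (i , j , pi , pj , p , path , uses) l-leaf with UsesEdge-endpoint p path uses l-leaf
  ... | inj₁ l≡i = i , pi , sym l≡i
  ... | inj₂ l≡j = j , pj , sym l≡j

  EdgeIn-ρ : ∀ {β a} → EdgeIn T part β a ρ → β ≡ part i₀
  EdgeIn-ρ e with EdgeIn-leaf e (leaf-deg T i₀)
  ... | i , pi , leafi≡ρ = trans (sym pi) (cong part (leaf-inj T i i₀ leafi≡ρ))

  EdgeIn-continues : ∀ {β c t} → EdgeIn T part β c t → ¬ IsLeaf t →
    ∃[ y ] (y ≢ c × EdgeIn T part β y t)
  EdgeIn-continues {t = t} (i , j , pi , pj , p , path@(hp , lp , _ , uq) , uses) t-internal
    with UsesEdge-inner p uq uses (leaf≢t i ∘ just-injective ∘ trans (sym hp))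
                                  (leaf≢t j ∘ just-injective ∘ trans (sym lp))
    where
    leaf≢t : ∀ i → leaf T i ≢ t
    leaf≢t i e = t-internal (subst IsLeaf e (leaf-deg T i))
  ... | y , y≢c , uses′ = y , y≢c , (i , j , pi , pj , p , path , uses′)

  Touches : Fin α → Fin N → Set
  Touches β v = (∃[ i ] (part i ≡ β × leaf T i ≡ v))
              ⊎ (¬ IsLeaf v × ∃[ c ] (c ≢ parent v × EdgeIn T part β c v))

  -- t is the vertex of T|L_β closest to the root ρ.
  IsTop : Fin α → Fin N → Set
  IsTop β t = Touches β t × ¬ EdgeIn T part β t (parent t) × t ≢ ρ

  IsTop-childEdges : ∀ {β t} → IsTop β t → ¬ IsLeaf t → ∀ {d} → parent d ≡ t → EdgeIn T part β d t
  IsTop-childEdges (inj₁ (i , _ , leafi≡t) , _) t-internal _ =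
    contradiction (subst IsLeaf leafi≡t (leaf-deg T i)) t-internal
  IsTop-childEdges {β} {t} (inj₂ (_ , c , c≢pt , e) , not-up , _) t-internal pd≡t
    with EdgeIn-continues e t-internal
  ... | y , y≢c , e′
    with siblings-two t-internal (below c≢pt e) (below y≢pt e′) pd≡t (y≢c ∘ sym)
    where
    below : ∀ {x} → x ≢ parent t → EdgeIn T part β x t → parent x ≡ t
    below x≢pt ex = Adj-nonparent⇒parent (Adj-sym (EdgeIn⇒Adj ex)) x≢pt
    y≢pt : y ≢ parent t
    y≢pt y≡pt = not-up (EdgeIn-sym (subst (λ z → EdgeIn T part β z t) y≡pt e′))
  ...   | inj₁ d≡c = subst (λ z → EdgeIn T part β z t) (sym d≡c) e
  ...   | inj₂ d≡y = subst (λ z → EdgeIn T part β z t) (sym d≡y) e′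

  IsTop-uncovered : ∀ {β t} → IsTop β t → ∀ γ → ¬ EdgeIn T part γ t (parent t)
  IsTop-uncovered {β} {t} (inj₁ (i , pi , leafi≡t) , not-up , _) γ e
    with EdgeIn-leaf (EdgeIn-sym e) (subst IsLeaf leafi≡t (leaf-deg T i))
  ... | i′ , pi′ , leafi′≡t = not-up (subst (λ δ → EdgeIn T part δ t (parent t)) γ≡β e)
    where
    γ≡β : γ ≡ β
    γ≡β = trans (sym pi′) (trans (cong part (leaf-inj T i′ i (trans leafi′≡t (sym leafi≡t)))) pi)
  IsTop-uncovered {β} {t} top@(inj₂ (t-internal , _) , not-up , _) γ e
    with EdgeIn-continues (EdgeIn-sym e) t-internal
  ... | y , y≢pt , e′ = not-up (subst (λ δ → EdgeIn T part δ t (parent t)) (sym β≡γ) e)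
    where
    β≡γ : β ≡ γ
    β≡γ = EdgeIn-unique
      (IsTop-childEdges top t-internal (Adj-nonparent⇒parent (Adj-sym (EdgeIn⇒Adj e′)) y≢pt)) e′

  IsTop-injective : ∀ {β γ t} → IsTop β t → IsTop γ t → β ≡ γ
  IsTop-injective (inj₁ (i , pi , leafi≡t) , _) (inj₁ (i′ , pi′ , leafi′≡t) , _) =
    trans (sym pi) (trans (cong part (leaf-inj T i i′ (trans leafi≡t (sym leafi′≡t)))) pi′)
  IsTop-injective (inj₁ (i , _ , leafi≡t) , _) (inj₂ (t-internal , _) , _) =
    contradiction (subst IsLeaf leafi≡t (leaf-deg T i)) t-internal
  IsTop-injective (inj₂ (t-internal , _) , _) (inj₁ (i , _ , leafi≡t) , _) =
    contradiction (subst IsLeaf leafi≡t (leaf-deg T i)) t-internal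
  IsTop-injective topβ@(inj₂ (t-internal , _) , _) topγ =
    EdgeIn-unique (IsTop-childEdges topβ t-internal (parent-child t-internal false))
                  (IsTop-childEdges topγ t-internal (parent-child t-internal false))

  Touches⇒≢ρ : ∀ {β v} → β ≢ part i₀ → Touches β v → v ≢ ρ
  Touches⇒≢ρ β≢β₀ (inj₁ (i , pi , leafi≡v)) v≡ρ =
    β≢β₀ (trans (sym pi) (cong part (leaf-inj T i i₀ (trans leafi≡v v≡ρ))))
  Touches⇒≢ρ β≢β₀ (inj₂ (v-internal , _)) = internal⇒≢ρ v-internal

  -- Climb from v while the edge to the parent stays in T|L_β; the climb stops below ρ,
  -- which is a leaf of another part.
  top-exists : ∀ {β} → β ≢ part i₀ → ∀ m v → depth v < m → Touches β v →
    DoubleNegation (∃[ t ] IsTop β t)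
  top-exists {β} β≢β₀ (suc m) v v<m touches = do
    yes e ← ¬¬-excluded-middle
      where no ¬e → pure (v , touches , ¬e , v≢ρ)
    let pv≢ρ = λ pv≡ρ → β≢β₀ (EdgeIn-ρ (subst (EdgeIn T part β v) pv≡ρ e))
    top-exists β≢β₀ m (parent v) (≤-trans (depth-parent< v≢ρ) (≤-pred v<m))
      (inj₂ (parent-internal v≢ρ pv≢ρ , v , v≢ppv pv≢ρ , e))
    where
    v≢ρ = Touches⇒≢ρ β≢β₀ touches
    v≢ppv : parent v ≢ ρ → v ≢ parent (parent v)
    v≢ppv pv≢ρ v≡ppv = depth-injective (<-trans (depth-parent< pv≢ρ) (depth-parent< v≢ρ)) (sym v≡ppv)

  CoversShortEdges : ℕ → Set
  CoversShortEdges r = ∀ a b → Adj (adj T) a b → ∀ l → IsStarLen T a b (Leaves T) l → l ≤ r →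
    ∃[ γ ] EdgeIn T part γ a b

  IsTop⇒ℓ*> : ∀ {β t r} → IsTop β t → CoversShortEdges r →
    ∀ l → IsStarLen T (parent t) t (Leaves T) l → ¬ l ≤ r
  IsTop⇒ℓ*> top@(_ , _ , t≢ρ) covers l ℓ* l≤r with covers _ _ (Adj-sym (Adj-parent t≢ρ)) l ℓ* l≤r
  ... | γ , e = IsTop-uncovered top γ (EdgeIn-sym e)

  record Charge (β : Fin α) (k : ℕ) : Set where
    field
      top    : Fin N
      isTop  : IsTop β top
      root   : Fin N
      anchor : Anchor top root
      full   : Full k root

  charge : ∀ k {β} → β ≢ part i₀ → ∃[ i ] part i ≡ β → CoversShortEdges (suc k) →
    DoubleNegation (Charge β k)
  charge k β≢β₀ (i , pi) covers = do
    t , top ← top-exists β≢β₀ _ (leaf T i) ≤-refl (inj₁ (i , pi , refl))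
    u , anchor , full ← ℓ*>⇒fullAnchor k (proj₂ (proj₂ top)) (IsTop⇒ℓ*> top covers)
    pure (record { top = t ; isTop = top ; root = u ; anchor = anchor ; full = full })

  -- A vertex hanging at one part's top vertex may also hang at the sibling of another's;
  -- the anchor tag tells these apart.
  charges⇒≤ : ∀ {m k} (β : Fin m → Fin α) → Injective _≡_ _≡_ β → (∀ j → Charge (β j) k) →
    m * 2 ^ k ≤ 2 * N
  charges⇒≤ {m} {k} β β-injective charges = injective₂⇒≤ reach reach-injective
    where
    open Charge

    reach : Fin m → Fin (2 ^ k) → Fin (2 * N)
    reach j σ = combine (anchorTag (anchor (charges j))) (descend (root (charges j)) (bits k σ))

    full-bits : ∀ j σ → AllInternal (root (charges j)) (bits k σ)
    full-bits j σ = full (charges j) (bits k σ) (length-bits k σ)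

    ancestor-reach : ∀ j σ → ancestor k (descend (root (charges j)) (bits k σ)) ≡ root (charges j)
    ancestor-reach j σ = ancestor-descend _ (bits k σ) (full-bits j σ) (length-bits k σ)

    reach-injective : ∀ {j j′ σ σ′} → reach j σ ≡ reach j′ σ′ → j ≡ j′ × σ ≡ σ′
    reach-injective {j} {j′} {σ} {σ′} e with combine-injective _ _ _ _ e
    ... | tag≡ , descend≡
      with β-injective (IsTop-injective (isTop (charges j))
                                        (subst (IsTop (β j′)) (sym top≡) (isTop (charges j′))))
      where
      root≡ : root (charges j) ≡ root (charges j′)
      root≡ = trans (sym (ancestor-reach j σ)) (trans (cong (ancestor k) descend≡) (ancestor-reach j′ σ′))
      top≡ : top (charges j) ≡ top (charges j′)
      top≡ = anchor-injective (anchor (charges j)) (anchor (charges j′)) root≡ tag≡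
    ... | refl = refl , bits-injective k (descend-injective _ (full-bits j σ) (full-bits j σ′)
                          (trans (length-bits k σ) (sym (length-bits k σ′))) descend≡)

lemma12 : ∀ {N n α : ℕ} (T : BinaryTree N n) (part : Fin n → Fin α) (r : ℕ) →
    (∀ β → ∃[ i ] part i ≡ β) →
    PairwiseEdgeDisjoint T part →
    (∀ a b → Adj (adj T) a b → ∀ k → IsStarLen T a b (Leaves T) k → k ≤ r →
      ∃[ β ] EdgeIn T part β a b) →
    2 ^ r * α ≤ 2 ^ r + 30 * n
lemma12 {α = zero} _ _ r _ _ _ = ≤-trans (≤-reflexive (*-zeroʳ (2 ^ r))) z≤n
lemma12 {n = n} {suc α} _ part zero surjective _ _ = begin
  1 * suc α   ≡⟨ *-identityˡ (suc α) ⟩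
  suc α       ≤⟨ surjective⇒≤ part surjective ⟩
  n           ≤⟨ m≤n*m n 30 ⟩
  30 * n      ≤⟨ m≤n+m (30 * n) 1 ⟩
  1 + 30 * n  ∎
  where open ≤-Reasoning
lemma12 {N} {n} {suc α} T part (suc k) surjective disjoint covers = decidable-stable (_ ≤? _) do
  charges ← sequence ¬¬.rawApplicative λ j → charge k (suc≢β₀ j) (surjective (suc j)) covers
  pure (charging-arithmetic α k n (charges⇒≤ suc Finₚ.suc-injective charges) N≤2*n)
  where
  i₀ = proj₁ (surjective zero)
  open Partition T part disjoint i₀
  suc≢β₀ : ∀ j → suc j ≢ part i₀
  suc≢β₀ j e with () ← trans e (proj₂ (surjective zero))
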